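{- Let $Y\xleftarrow{g}Z\xrightarrow{f}X$ be a span in $\mathbf{EHyp}(\Sigma)$ such that (1) $Z$ is a discrete e-hypergraph; (2) for all $v_i,v_j\in V_Z$, $[f_V(v_i))=[f_V(v_j))$ and $[g_V(v_i))=[g_V(v_j))$; (3) for all $v\in V_Z$, if $[f_V(v))\neq\varnothing$ then $[g_V(v))=\varnothing$, and if $[g_V(v))\neq\varnothing$ then $[f_V(v))=\varnothing$; (4) for all $v_i,v_j\in V_Z$, ${\smile}(f_V(v_i))={\smile}(f_V(v_j))$ and ${\smile}(g_V(v_i))={\smile}(g_V(v_j))$. Then the pushout $X+_{f,g}Y$ exists in $\mathbf{EHyp}(\Sigma)$.
   Context: E-hypergraph over a monoidal signature $\Sigma$: $(V,E,s,t,l,<,\smile)$ where $(V,E,s,t)$ is a finite hypergraph ($s,t:E\to V^*$), $l:E\to\Sigma+\{\bot\}$ (respecting arities for $\Sigma$-labels), $<$ a strict partial order on $V+E$; $[x)=\{x'\mid x'<x\}$ is the set of predecessors (parents) of $x$, and $e<^\mu x$ means $e$ is the immediate predecessor of $x$. Edges labelled $\bot$ are hierarchical; elements with $[x)=\varnothing$ are top-level; an edge with no successors is maximal. Conditions: every predecessor is a hierarchical edge; each element has at most one immediate predecessor; maximal edges are not labelled $\bot$; if $v\in s(e)$ or $v\in t(e)$ then $e'<^\mu e$ iff $e'<^\mu v$. $\smile$ is the union of equivalence relations $\smile_p$, one on each set $C_p=\{x\mid p<^\mu x\}$ of immediate children of a hierarchical edge $p$, closed under connectivity (if $v\in s(e)\cup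 t(e)$ with $v,e\in C_p$ then $v\smile_p e$), with $\smile_p\neq C_p\times C_p$; ${\smile}(x)$ denotes the set of elements related to $x$ (empty for top-level $x$). A homomorphism $\phi:\mathcal{F}\to\mathcal{G}$ is a pair $\phi_V,\phi_E$ preserving sources, targets and labels, preserving immediate predecessors ($e<^\mu_{\mathcal{F}}x\Rightarrow\phi(e)<^\mu_{\mathcal{G}}\phi(x)$), and preserving $\smile$. $\mathbf{EHyp}(\Sigma)$ is the category of e-hypergraphs and homomorphisms; a discrete e-hypergraph has no edges. -}

module Defs where

open import Data.Nat using (ℕ; zero)
open import Data.Fin using (Fin)
open import Data.Sum using (_⊎_; inj₁; inj₂)
open import Data.Sum.Base as Sum using ()
open import Data.Product using (Σ; _×_; _,_)
open import Data.Bool using (Bool; T)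
open import Data.Maybe using (Maybe; just; nothing)
open import Data.List using (List; length; map)
open import Data.List.Membership.Propositional using (_∈_)
open import Data.Empty using (⊥)
open import Relation.Nullary using (¬_)
open import Relation.Binary.PropositionalEquality using (_≡_; _≢_)
open import Relation.Unary using (Pred; _≐_; Empty)
open import Level using (0ℓ)

record Signature : Set₁ where
  field
    Gen  : Set
    arity   : Gen → ℕ
    coarity : Gen → ℕ

-- A label 'nothing' stands for ⊥ (hierarchical edge).
record RawEHyp (S : Signature) : Set where
  open Signature S
  field
    nV nE : ℕ
    src tgt : Fin nE → List (Fin nV)
    lab : Fin nE → Maybe Gen
    lt  : Fin nV ⊎ Fin nE → Fin nV ⊎ Fin nE → Bool
    sm  : Fin nV ⊎ Fin nE → Fin nV ⊎ Fin nE → Bool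

  El : Set
  El = Fin nV ⊎ Fin nE

  _<_ : El → El → Set
  x < y = T (lt x y)

  _⌣_ : El → El → Set
  x ⌣ y = T (sm x y)

  _<μ_ : El → El → Set
  e <μ x = (e < x) × (∀ y → e < y → ¬ (y < x))

  -- [x) : the set of predecessors of x
  preds : El → Pred El 0ℓ
  preds x = λ y → y < x

  -- ⌣(x) : the set of elements related to x
  smSet : El → Pred El 0ℓ
  smSet x = λ y → x ⌣ y

  Hierarchical : Fin nE → Set
  Hierarchical e = lab e ≡ nothing

  Incident : Fin nV → Fin nE → Set
  Incident v e = (v ∈ src e) ⊎ (v ∈ tgt e)

record IsEHyp {S : Signature} (G : RawEHyp S) : Set where
  open Signature S
  open RawEHyp G
  field
    arities : ∀ e σ → lab e ≡ just σ →
              (length (src e) ≡ arity σ) × (length (tgt e) ≡ coarity σ)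
    irrefl  : ∀ x → ¬ (x < x)
    trans   : ∀ x y z → x < y → y < z → x < z
    predHier : ∀ x y → x < y → Σ (Fin nE) λ e → (x ≡ inj₂ e) × Hierarchical e
    uniqueImm : ∀ p q x → p <μ x → q <μ x → p ≡ q
    maximalNotHier : ∀ e → (∀ y → ¬ (inj₂ e < y)) → lab e ≢ nothing
    incidentImm : ∀ v e → Incident v e → ∀ e' →
                  ((e' <μ inj₂ e → e' <μ inj₁ v) × (e' <μ inj₁ v → e' <μ inj₂ e))
    smSiblings : ∀ x y → x ⌣ y → Σ El λ p → (p <μ x) × (p <μ y)
    smRefl  : ∀ p x → p <μ x → x ⌣ x
    smSym   : ∀ x y → x ⌣ y → y ⌣ x
    smTrans : ∀ x y z → x ⌣ y → y ⌣ z → x ⌣ z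
    smConn  : ∀ p v e → Incident v e → p <μ inj₁ v → p <μ inj₂ e → inj₁ v ⌣ inj₂ e
    smProper : ∀ p → Hierarchical p →
               Σ El λ x → Σ El λ y → (inj₂ p <μ x) × (inj₂ p <μ y) × ¬ (x ⌣ y)

record EHyp (S : Signature) : Set where
  field
    raw : RawEHyp S
    wf  : IsEHyp raw
  open RawEHyp raw public

record Hom {S : Signature} (F G : EHyp S) : Set where
  private
    module F = EHyp F
    module G = EHyp G
  field
    fV : Fin F.nV → Fin G.nV
    fE : Fin F.nE → Fin G.nE

  fEl : F.El → G.El
  fEl = Sum.map fV fE

  field
    presSrc : ∀ e → G.src (fE e) ≡ map fV (F.src e)
    presTgt : ∀ e → G.tgt (fE e) ≡ map fV (F.tgt e)
    presLab : ∀ e → G.lab (fE e) ≡ F.lab e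
    presImm : ∀ p x → p F.<μ x → fEl p G.<μ fEl x
    presSm  : ∀ x y → x F.⌣ y → fEl x G.⌣ fEl y

open Hom public

CompEq : ∀ {S} {A B C B' : EHyp S} →
         Hom B C → Hom A B → Hom B' C → Hom A B' → Set
CompEq h k h' k' =
  (∀ v → fV h (fV k v) ≡ fV h' (fV k' v)) × (∀ e → fE h (fE k e) ≡ fE h' (fE k' e))

HomEq : ∀ {S} {A B : EHyp S} → Hom A B → Hom A B → Set
HomEq h h' = (∀ v → fV h v ≡ fV h' v) × (∀ e → fE h e ≡ fE h' e)

Factors : ∀ {S} {A B C : EHyp S} → Hom B C → Hom A B → Hom A C → Set
Factors u h h' = (∀ v → fV u (fV h v) ≡ fV h' v) × (∀ e → fE u (fE h e) ≡ fE h' e)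

record IsPushout {S} {Z X Y P : EHyp S} (f : Hom Z X) (g : Hom Z Y)
                 (i : Hom X P) (j : Hom Y P) : Set₁ where
  field
    commutes  : CompEq i f j g
    universal : ∀ (Q : EHyp S) (i' : Hom X Q) (j' : Hom Y Q) → CompEq i' f j' g →
                Σ (Hom P Q) λ u →
                  Factors u i i' × Factors u j j' ×
                  (∀ (u' : Hom P Q) → Factors u' i i' → Factors u' j j' → HomEq u' u)

PushoutExists : ∀ {S} {Z X Y : EHyp S} → Hom Z X → Hom Z Y → Set₁
PushoutExists {S} {Z} {X} {Y} f g =
  Σ (EHyp S) λ P → Σ (Hom X P) λ i → Σ (Hom Y P) λ j → IsPushout f g i j

Discrete : ∀ {S} → EHyp S → Set
Discrete G = EHyp.nE G ≡ zero

{-# OPTIONS --safe #-}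
-- By (2) and (3) only one leg can glue onto nested vertices, so up to swapping the span all g z
-- are top-level in Y. The pushout is X ⊔ Y with each f z identified with g z. Since incident
-- vertices and edges share their immediate predecessor, the whole top-level component of Y
-- reachable from g(Z) through incidences (its "attached" elements) must move into the
-- hierarchical edges enclosing f(Z) and into the ⌣-class of f(Z), and everything nested in
-- attached edges follows; by (2) and (4) these targets do not depend on z. A cocone is forced to
-- respect this structure, by induction along the incidences of the attached component, which
-- gives the universal property. Relations on the quotient are computed on representatives in
-- X ⊔ Y; this is sound because each of them is invariant under the gluing.
module Submission where

open import Defs
open import Data.Empty using (⊥)
open import Data.Fin using (Fin; splitAt; join; _≟_; punchIn; punchOut)
open import Data.Fin.Induction using (spo-noetherian)
open import Data.Fin.Properties
  using (any?; all?; ¬∀⟶∃¬; ¬Fin0; splitAt-join; join-splitAt; punchOut-punchIn; punchIn-punchOut; punchOut-cong; punchInᵢ≢i)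
open import Data.Maybe using (Maybe; nothing; just)
open import Data.List using (List; []; _∷_; map; filter; cartesianProduct; allFin; length)
open import Data.List.Properties using (length-map; map-cong; map-∘)
open import Data.List.Membership.Propositional using (_∈_)
open import Data.List.Membership.Propositional.Properties
  using (∈-map⁺; ∈-map⁻; ∈-filter⁺; ∈-filter⁻; ∈-cartesianProduct⁺; ∈-allFin)
open import Data.List.Relation.Unary.Any using (here; there)
open import Data.Nat using (ℕ; suc; _+_)
open import Data.Product using (∃; _×_; _,_; proj₁; proj₂; uncurry)
open import Data.Sum using (_⊎_; inj₁; inj₂; [_,_])
import Data.Sum as Sum
open import Function using (_∘_; flip)
open import Function.Bundles using (_⇔_; mk⇔; Equivalence)
open import Function.Properties.Equivalence using (⇔-isEquivalence)
open import Data.Product.Function.NonDependent.Propositional using (_×-⇔_)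
open import Induction.WellFounded using (WellFounded; Acc; acc; module Subrelation)
import Relation.Binary.Construct.On as On
open import Level using (0ℓ)
open import Relation.Binary.Definitions using (Decidable)
open import Relation.Binary.PropositionalEquality using (_≡_; _≢_; refl; sym; trans; cong; subst; subst₂; resp₂)
  renaming (isEquivalence to ≡-isEquivalence)
open import Relation.Binary.Structures using (IsEquivalence; IsStrictPartialOrder)
open import Relation.Nullary using (¬_; Dec; yes; no; contradiction)
open import Relation.Nullary.Decidable using (map′; _×-dec_; _⊎-dec_; ¬?; T?; ⌊_⌋; toWitness; fromWitness)
open import Relation.Unary using (_≐_; Empty)

open Equivalence using (to; from)
module ⇔ = IsEquivalence (⇔-isEquivalence {0ℓ})

≡⇒⇔ : {A : Set} (P : A → Set) {x y : A} → x ≡ y → P x ⇔ P y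
≡⇒⇔ P refl = ⇔.refl

Invariant : {A : Set} → (A → A → Set) → (A → Set) → Set
Invariant _~_ P = ∀ {a b} → a ~ b → P a ⇔ P b

-- The quotient of A by the equivalence generated by _~_: rep-quot says that a is
-- connected to the representative of its class, as no ~-invariant predicate separates them.
record Quotient (A : Set) (_~_ : A → A → Set) : Set₁ where
  field
    size     : ℕ
    quot     : A → Fin size
    rep      : Fin size → A
    quot-rep : ∀ c → quot (rep c) ≡ c
    glue     : ∀ {a b} → a ~ b → quot a ≡ quot b
    rep-quot : ∀ P → Invariant _~_ P → ∀ a → P a ⇔ P (rep (quot a))

  quot-invariant : ∀ P → Invariant _~_ P → ∀ {a b} → quot a ≡ quot b → P a → P b
  quot-invariant P inv {a} {b} eq pa =
    from (rep-quot P inv b) (subst (P ∘ rep) eq (to (rep-quot P inv a) pa))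

idQuotient : ∀ {n} {_~_ : Fin n → Fin n → Set} → (∀ {a b} → a ~ b → a ≡ b) → Quotient (Fin n) _~_
idQuotient {n} ~⇒≡ = record
  { size = n ; quot = λ a → a ; rep = λ c → c ; quot-rep = λ _ → refl
  ; glue = ~⇒≡ ; rep-quot = λ _ _ _ → ⇔.refl }

Quotient-resp : ∀ {A} {_~_ _≈_ : A → A → Set} →
                (∀ {a b} → a ~ b → a ≈ b) → (∀ {a b} → a ≈ b → a ~ b) →
                Quotient A _≈_ → Quotient A _~_
Quotient-resp ~⇒≈ ≈⇒~ Q = record
  { size = size ; quot = quot ; rep = rep ; quot-rep = quot-rep
  ; glue = glue ∘ ~⇒≈ ; rep-quot = λ P inv → rep-quot P (inv ∘ ≈⇒~) }
  where open Quotient Q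

module _ {n} {i j : Fin (suc n)} (i≢j : i ≢ j) where

  merge : Fin (suc n) → Fin n
  merge a with i ≟ a
  ... | yes _   = punchOut i≢j
  ... | no i≢a = punchOut i≢a

  merge-i : merge i ≡ punchOut i≢j
  merge-i with i ≟ i
  ... | yes _   = refl
  ... | no i≢i = contradiction refl i≢i

  merge-≢ : ∀ {a} (i≢a : i ≢ a) → merge a ≡ punchOut i≢a
  merge-≢ {a} i≢a with i ≟ a
  ... | yes i≡a = contradiction i≡a i≢a
  ... | no _    = punchOut-cong i refl

  merge-punchIn : ∀ c → merge (punchIn i c) ≡ c
  merge-punchIn c = trans (merge-≢ (punchInᵢ≢i i c ∘ sym)) (punchOut-punchIn i)

  merge-glue : merge i ≡ merge j
  merge-glue = trans merge-i (sym (merge-≢ i≢j))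

  punchIn-merge : ∀ P → P i ⇔ P j → ∀ a → P a ⇔ P (punchIn i (merge a))
  punchIn-merge P Pi⇔Pj a with i ≟ a
  ... | yes refl = ⇔.trans Pi⇔Pj (≡⇒⇔ P (sym (trans (cong (punchIn i) merge-i) (punchIn-punchOut i≢j))))
  ... | no i≢a   = ≡⇒⇔ P (sym (trans (cong (punchIn i) (merge-≢ i≢a)) (punchIn-punchOut i≢a)))

identify : ∀ {n} (i j : Fin n) → Quotient (Fin n) (λ a b → (a , b) ≡ (i , j))
identify i j with i ≟ j
... | yes refl = idQuotient λ { refl → refl }
identify {suc n} i j | no i≢j = record
  { size = n ; quot = merge i≢j ; rep = punchIn i ; quot-rep = merge-punchIn i≢j
  ; glue = λ { refl → merge-glue i≢j }
  ; rep-quot = λ P inv → punchIn-merge i≢j P (inv refl) }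

pairQuotient : ∀ {N} (ps : List (Fin N × Fin N)) → Quotient (Fin N) (λ a b → (a , b) ∈ ps)
pairQuotient [] = idQuotient λ ()
pairQuotient ((i , j) ∷ ps) = record
  { size = S.size ; quot = S.quot ∘ Q.quot ; rep = Q.rep ∘ S.rep
  ; quot-rep = λ c → trans (cong S.quot (Q.quot-rep (S.rep c))) (S.quot-rep c)
  ; glue = λ { (here refl) → S.glue refl ; (there p) → cong S.quot (Q.glue p) }
  ; rep-quot = λ P inv a →
      ⇔.trans (Q.rep-quot P (inv ∘ there) a) (S.rep-quot (P ∘ Q.rep) (λ { refl → P-ij P inv }) (Q.quot a)) }
  where
    module Q = Quotient (pairQuotient ps)
    module S = Quotient (identify (Q.quot i) (Q.quot j))
    P-ij : ∀ P → Invariant (λ a b → (a , b) ∈ (i , j) ∷ ps) P → P (Q.rep (Q.quot i)) ⇔ P (Q.rep (Q.quot j))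
    P-ij P inv = ⇔.trans (⇔.sym (Q.rep-quot P (inv ∘ there) i))
                         (⇔.trans (inv (here refl)) (Q.rep-quot P (inv ∘ there) j))

quotient : ∀ {N} {_~_ : Fin N → Fin N → Set} → Decidable _~_ → Quotient (Fin N) _~_
quotient {N} _~?_ = Quotient-resp
  (∈-filter⁺ (uncurry _~?_) (∈-cartesianProduct⁺ (∈-allFin _) (∈-allFin _)))
  (proj₂ ∘ ∈-filter⁻ (uncurry _~?_) {xs = allPairs})
  (pairQuotient (filter (uncurry _~?_) allPairs))
  where
    allPairs : List (Fin N × Fin N)
    allPairs = cartesianProduct (allFin N) (allFin N)

quotient⊎ : ∀ {m n} {_~_ : Fin m ⊎ Fin n → Fin m ⊎ Fin n → Set} → Decidable _~_ →
            Quotient (Fin m ⊎ Fin n) _~_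
quotient⊎ {m} {n} {_~_} _~?_ = record
  { size = Q.size ; quot = Q.quot ∘ join m n ; rep = splitAt m ∘ Q.rep
  ; quot-rep = λ c → trans (cong Q.quot (join-splitAt m n (Q.rep c))) (Q.quot-rep c)
  ; glue = λ {a} {b} a~b → Q.glue (subst₂ _~_ (sym (splitAt-join m n a)) (sym (splitAt-join m n b)) a~b)
  ; rep-quot = λ P inv a →
      ⇔.trans (≡⇒⇔ P (sym (splitAt-join m n a))) (Q.rep-quot (P ∘ splitAt m) inv (join m n a)) }
  where
    module Q = Quotient (quotient {_~_ = λ i j → splitAt m i ~ splitAt m j} (λ i j → splitAt m i ~? splitAt m j))

any⊎? : ∀ {m n} {P : Fin m ⊎ Fin n → Set} → (∀ x → Dec (P x)) → Dec (∃ P)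
any⊎? P? = map′ [ (λ (i , p) → inj₁ i , p) , (λ (i , p) → inj₂ i , p) ]
                (λ { (inj₁ i , p) → inj₁ (i , p) ; (inj₂ i , p) → inj₂ (i , p) })
                (any? (P? ∘ inj₁) ⊎-dec any? (P? ∘ inj₂))

∈-map⁻-⊎ : ∀ {A B : Set} (h : A → B) {b xs ys} → b ∈ map h xs ⊎ b ∈ map h ys →
           ∃ λ a → (a ∈ xs ⊎ a ∈ ys) × b ≡ h a
∈-map⁻-⊎ h (inj₁ b∈) = let (a , a∈ , eq) = ∈-map⁻ h b∈ in a , inj₁ a∈ , eq
∈-map⁻-⊎ h (inj₂ b∈) = let (a , a∈ , eq) = ∈-map⁻ h b∈ in a , inj₂ a∈ , eq

module EHypProperties {S : Signature} (G : EHyp S) where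
  open EHyp G public
  open IsEHyp wf public renaming (irrefl to <-irrefl; trans to <-trans)
  open import Data.List.Membership.DecPropositional (_≟_ {nV}) using (_∈?_)

  TopLevel : El → Set
  TopLevel x = Empty (preds x)

  _<?_ : Decidable _<_
  x <? y = T? (lt x y)

  _⌣?_ : Decidable _⌣_
  x ⌣? y = T? (sm x y)

  TopLevel? : ∀ x → Dec (TopLevel x)
  TopLevel? x = map′ (λ ∄y y y<x → ∄y (y , y<x)) (λ top (y , y<x) → top y y<x) (¬? (any⊎? (_<? x)))

  incident? : ∀ v e → Dec (Incident v e)
  incident? v e = (v ∈? src e) ⊎-dec (v ∈? tgt e)

  data HierarchicalEl : El → Set where
    hierarchical : ∀ {e} → Hierarchical e → HierarchicalEl (inj₂ e)

  <⇒HierarchicalEl : ∀ {x y} → x < y → HierarchicalEl x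
  <⇒HierarchicalEl x<y with predHier _ _ x<y
  ... | _ , refl , hier = hierarchical hier

  vertex-≮ : ∀ {v y} → ¬ (inj₁ v < y)
  vertex-≮ v<y with <⇒HierarchicalEl v<y
  ... | ()

  <-noetherian : WellFounded (flip _<_)
  <-noetherian = Subrelation.wellFounded {_<₁_ = flip _<_} via-join
                   (On.wellFounded (join nV nE) (spo-noetherian ⊏-isStrictPartialOrder))
    where
      _⊏_ : Fin (nV + nE) → Fin (nV + nE) → Set
      i ⊏ j = splitAt nV i < splitAt nV j
      ⊏-isStrictPartialOrder : IsStrictPartialOrder _≡_ _⊏_
      ⊏-isStrictPartialOrder = record
        { isEquivalence = ≡-isEquivalence
        ; irrefl = λ { refl → <-irrefl _ }
        ; trans = <-trans _ _ _
        ; <-resp-≈ = resp₂ _⊏_ }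
      via-join : ∀ {x y} → y < x → join nV nE y ⊏ join nV nE x
      via-join {x} {y} = subst₂ _<_ (sym (splitAt-join nV nE y)) (sym (splitAt-join nV nE x))

  <⇒∃<μ : ∀ {a x} → a < x → ∃ (_<μ x)
  <⇒∃<μ {a} = climb (<-noetherian a)
    where
      climb : ∀ {a x} → Acc (flip _<_) a → a < x → ∃ (_<μ x)
      climb {a} {x} (acc rs) a<x with any⊎? (λ y → (a <? y) ×-dec (y <? x))
      ... | yes (y , a<y , y<x) = climb (rs a<y) y<x
      ... | no ∄y = a , a<x , λ y a<y y<x → ∄y (y , a<y , y<x)

  TopLevel⇔∄<μ : ∀ x → TopLevel x ⇔ (∀ p → ¬ p <μ x)
  TopLevel⇔∄<μ x = mk⇔ (λ top p (p<x , _) → top p p<x)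
                       (λ ∄p y y<x → let (p , p<μx) = <⇒∃<μ y<x in ∄p p p<μx)

  <μ-incident : ∀ {v e} → Incident v e → ∀ p → p <μ inj₂ e ⇔ p <μ inj₁ v
  <μ-incident i p = mk⇔ (proj₁ (incidentImm _ _ i p)) (proj₂ (incidentImm _ _ i p))

  TopLevel-incident : ∀ {v e} → Incident v e → TopLevel (inj₁ v) ⇔ TopLevel (inj₂ e)
  TopLevel-incident {v} {e} i =
    ⇔.trans (TopLevel⇔∄<μ (inj₁ v)) (⇔.trans ∄-incident (⇔.sym (TopLevel⇔∄<μ (inj₂ e))))
    where
      ∄-incident : (∀ p → ¬ p <μ inj₁ v) ⇔ (∀ p → ¬ p <μ inj₂ e)
      ∄-incident = mk⇔ (λ ∄p p → ∄p p ∘ to (<μ-incident i p))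
                       (λ ∄p p → ∄p p ∘ from (<μ-incident i p))

  ⌣⇒¬TopLevel : ∀ {x y} → x ⌣ y → ¬ TopLevel x
  ⌣⇒¬TopLevel {x} {y} x⌣y top with smSiblings x y x⌣y
  ... | p , p<μx , _ = to (TopLevel⇔∄<μ x) top p p<μx

presIncident : ∀ {S} {F G : EHyp S} (h : Hom F G) {v e} →
               EHyp.Incident F v e → EHyp.Incident G (fV h v) (fE h e)
presIncident h {v} {e} (inj₁ v∈src) = inj₁ (subst (fV h v ∈_) (sym (presSrc h e)) (∈-map⁺ (fV h) v∈src))
presIncident h {v} {e} (inj₂ v∈tgt) = inj₂ (subst (fV h v ∈_) (sym (presTgt h e)) (∈-map⁺ (fV h) v∈tgt))

module Gluing {S : Signature} {Z X Y : EHyp S} (f : Hom Z X) (g : Hom Z Y)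
  (f-preds : ∀ zi zj → EHyp.preds X (inj₁ (fV f zi)) ≐ EHyp.preds X (inj₁ (fV f zj)))
  (f-smSet : ∀ zi zj → EHyp.smSet X (inj₁ (fV f zi)) ≐ EHyp.smSet X (inj₁ (fV f zj)))
  (g-top : ∀ z → Empty (EHyp.preds Y (inj₁ (fV g z))))
  where

  module X = EHypProperties X
  module Y = EHypProperties Y
  module Z = EHyp Z

  fz : Fin Z.nV → X.El
  fz z = inj₁ (fV f z)

  gz : Fin Z.nV → Y.El
  gz z = inj₁ (fV g z)

  data Link : Y.El → Y.El → Set where
    link : ∀ {v e} → Y.Incident v e → Y.TopLevel (inj₂ e) → Link (inj₁ v) (inj₂ e)

  link? : Decidable Link
  link? (inj₁ v) (inj₂ e) = map′ (uncurry link) (λ { (link i top) → i , top })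
                                 (Y.incident? v e ×-dec Y.TopLevel? (inj₂ e))
  link? (inj₁ _) (inj₁ _) = no λ ()
  link? (inj₂ _) _        = no λ ()

  module Component = Quotient (quotient⊎ link?)

  record Attached (y : Y.El) : Set where
    constructor attached
    field
      glueVertex    : Fin Z.nV
      sameComponent : Component.quot y ≡ Component.quot (gz glueVertex)

  Attached? : ∀ y → Dec (Attached y)
  Attached? y = map′ (uncurry attached) (λ { (attached z eq) → z , eq })
                     (any? λ z → Component.quot y ≟ Component.quot (gz z))

  attached-gz : ∀ z → Attached (gz z)
  attached-gz z = attached z refl

  attached-induction : ∀ (P : Y.El → Set) → Invariant Link P → (∀ z → P (gz z)) →
                       ∀ y → Attached y → P y
  attached-induction P inv base _ (attached z y≈gz) = Component.quot-invariant P inv (sym y≈gz) (base z)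

  attached-TopLevel : ∀ {y} → Attached y → Y.TopLevel y
  attached-TopLevel = attached-induction Y.TopLevel (λ { (link i _) → Y.TopLevel-incident i }) g-top _

  attached-¬⌣ : ∀ {y y'} → Attached y → ¬ (y Y.⌣ y')
  attached-¬⌣ att y⌣y' = Y.⌣⇒¬TopLevel y⌣y' (attached-TopLevel att)

  Attached-incident : ∀ {v e} → Y.Incident v e → Attached (inj₁ v) ⇔ Attached (inj₂ e)
  Attached-incident i = mk⇔
    (λ att@(attached z eq) →
       attached z (trans (sym (Component.glue (link i (to (Y.TopLevel-incident i) (attached-TopLevel att))))) eq))
    (λ att@(attached z eq) → attached z (trans (Component.glue (link i (attached-TopLevel att))) eq))

  Encloses : X.El → Set
  Encloses a = ∃ λ z → a X.< fz z

  encloses-all : ∀ {a} → Encloses a → ∀ z → a X.< fz z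
  encloses-all (z' , a<fz') z = proj₁ (f-preds z' z) a<fz'

  <μ-fz : ∀ {p z} z' → p X.<μ fz z → p X.<μ fz z'
  <μ-fz {z = z} z' (p<fz , imm) =
    encloses-all (z , p<fz) z' , λ y p<y y<fz' → imm y p<y (encloses-all (z' , y<fz') z)

  GlueSibling : X.El → Set
  GlueSibling a = ∃ λ z → fz z X.⌣ a

  glueSibling-all : ∀ {a} → GlueSibling a → ∀ z → fz z X.⌣ a
  glueSibling-all (z' , fz'⌣a) z = proj₁ (f-smSet z' z) fz'⌣a

  -- fz z ⌣ fz z holds iff fz z lies inside a hierarchical edge
  GlueNested : Set
  GlueNested = ∃ λ z → fz z X.⌣ fz z

  GlueSibling⇒GlueNested : ∀ {a} → GlueSibling a → GlueNested
  GlueSibling⇒GlueNested (z , fz⌣a) = z , X.smTrans _ _ _ fz⌣a (X.smSym _ _ fz⌣a)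

  GlueNested⇒GlueSibling : ∀ z → GlueNested → GlueSibling (fz z)
  GlueNested⇒GlueSibling z (z' , s) = z' , X.smSym _ _ (proj₁ (f-smSet z' z) s)

  Moved : Y.El → Set
  Moved y = Attached y ⊎ ∃ λ r → Attached r × r Y.< y

  Moved-< : ∀ {b c} → Moved b → b Y.< c → Moved c
  Moved-< (inj₁ att) b<c = inj₂ (_ , att , b<c)
  Moved-< (inj₂ (r , att , r<b)) b<c = inj₂ (r , att , Y.<-trans _ _ _ r<b b<c)

  U : Set
  U = X.El ⊎ Y.El

  _<U_ : U → U → Set
  inj₁ a <U inj₁ b = a X.< b
  inj₂ a <U inj₂ b = a Y.< b
  inj₁ a <U inj₂ b = Encloses a × Moved b
  inj₂ _ <U inj₁ _ = ⊥

  _<U?_ : Decidable _<U_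
  inj₁ a <U? inj₁ b = a X.<? b
  inj₂ a <U? inj₂ b = a Y.<? b
  inj₁ a <U? inj₂ b = any? (λ z → a X.<? fz z)
                      ×-dec (Attached? b ⊎-dec any⊎? (λ r → Attached? r ×-dec r Y.<? b))
  inj₂ _ <U? inj₁ _ = no λ ()

  _⌣U_ : U → U → Set
  inj₁ a ⌣U inj₁ b = a X.⌣ b
  inj₂ a ⌣U inj₂ b = a Y.⌣ b ⊎ (Attached a × Attached b × GlueNested)
  inj₁ a ⌣U inj₂ b = GlueSibling a × Attached b
  inj₂ a ⌣U inj₁ b = Attached a × GlueSibling b

  _⌣U?_ : Decidable _⌣U_
  inj₁ a ⌣U? inj₁ b = a X.⌣? b
  inj₂ a ⌣U? inj₂ b = a Y.⌣? b ⊎-dec (Attached? a ×-dec Attached? b ×-dec any? (λ z → fz z X.⌣? fz z))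
  inj₁ a ⌣U? inj₂ b = any? (λ z → fz z X.⌣? a) ×-dec Attached? b
  inj₂ a ⌣U? inj₁ b = Attached? a ×-dec any? (λ z → fz z X.⌣? b)

  _<μU_ : U → U → Set
  u <μU w = u <U w × (∀ c → u <U c → ¬ c <U w)

  <μU-X : ∀ {p x} → inj₁ p <μU inj₁ x ⇔ p X.<μ x
  <μU-X = mk⇔ (λ (p<x , imm) → p<x , λ y → imm (inj₁ y))
              (λ (p<x , imm) → p<x , λ { (inj₁ y) → imm y ; (inj₂ _) _ () })

  <μU-Y : ∀ {p y} → inj₂ p <μU inj₂ y ⇔ p Y.<μ y
  <μU-Y = mk⇔ (λ (p<y , imm) → p<y , λ c → imm (inj₂ c))
              (λ (p<y , imm) → p<y , λ { (inj₂ c) → imm c ; (inj₁ _) () })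

  <μU-XY : ∀ {p y} → inj₁ p <μU inj₂ y ⇔ (Attached y × ∃ λ z → p X.<μ fz z)
  <μU-XY {p} {y} = mk⇔ to′ from′
    where
      to′ : inj₁ p <μU inj₂ y → Attached y × ∃ λ z → p X.<μ fz z
      to′ ((enc , inj₂ (r , att , r<y)) , imm) = contradiction r<y (imm (inj₂ r) (enc , inj₁ att))
      to′ (((z , p<fz) , inj₁ att) , imm) =
        att , z , p<fz , λ c p<c c<fz → imm (inj₁ c) p<c ((z , c<fz) , inj₁ att)
      from′ : Attached y × (∃ λ z → p X.<μ fz z) → inj₁ p <μU inj₂ y
      from′ (att , z , p<fz , imm) = ((z , p<fz) , inj₁ att) , λ
        { (inj₁ c) p<c (enc , _) → imm c p<c (encloses-all enc z)
        ; (inj₂ c) _ c<y → attached-TopLevel att c c<y }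

  <U-irrefl : ∀ u → ¬ u <U u
  <U-irrefl (inj₁ a) = X.<-irrefl a
  <U-irrefl (inj₂ a) = Y.<-irrefl a

  <U-trans : ∀ u v w → u <U v → v <U w → u <U w
  <U-trans (inj₁ a) (inj₁ b) (inj₁ c) a<b b<c = X.<-trans a b c a<b b<c
  <U-trans (inj₁ a) (inj₁ b) (inj₂ c) a<b ((z , b<fz) , moved) = (z , X.<-trans _ _ _ a<b b<fz) , moved
  <U-trans (inj₁ a) (inj₂ b) (inj₂ c) (enc , moved) b<c = enc , Moved-< moved b<c
  <U-trans (inj₂ a) (inj₂ b) (inj₂ c) a<b b<c = Y.<-trans a b c a<b b<c
  <U-trans (inj₁ _) (inj₂ _) (inj₁ _) _ ()
  <U-trans (inj₂ _) (inj₂ _) (inj₁ _) _ ()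
  <U-trans (inj₂ _) (inj₁ _) _ ()

  HierarchicalU : U → Set
  HierarchicalU = [ X.HierarchicalEl , Y.HierarchicalEl ]

  <U⇒Hierarchical : ∀ u w → u <U w → HierarchicalU u
  <U⇒Hierarchical (inj₁ _) (inj₁ _) a<b = X.<⇒HierarchicalEl a<b
  <U⇒Hierarchical (inj₂ _) (inj₂ _) a<b = Y.<⇒HierarchicalEl a<b
  <U⇒Hierarchical (inj₁ _) (inj₂ _) ((_ , a<fz) , _) = X.<⇒HierarchicalEl a<fz

  <μU-unique : ∀ p q x → p <μU x → q <μU x → p ≡ q
  <μU-unique (inj₁ a) (inj₁ b) (inj₁ x) ma mb = cong inj₁ (X.uniqueImm a b x (to <μU-X ma) (to <μU-X mb))
  <μU-unique (inj₂ a) (inj₂ b) (inj₂ x) ma mb = cong inj₂ (Y.uniqueImm a b x (to <μU-Y ma) (to <μU-Y mb))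
  <μU-unique (inj₁ a) (inj₁ b) (inj₂ x) ma mb with to <μU-XY ma | to <μU-XY mb
  ... | _ , z , a<μfz | _ , z' , b<μfz' = cong inj₁ (X.uniqueImm a b (fz z) a<μfz (<μ-fz z b<μfz'))
  <μU-unique (inj₁ _) (inj₂ b) (inj₂ _) ma (b<x , _) =
    contradiction b<x (attached-TopLevel (proj₁ (to <μU-XY ma)) b)
  <μU-unique (inj₂ a) (inj₁ _) (inj₂ _) (a<x , _) mb =
    contradiction a<x (attached-TopLevel (proj₁ (to <μU-XY mb)) a)
  <μU-unique (inj₂ _) _ (inj₁ _) (() , _)
  <μU-unique (inj₁ _) (inj₂ _) (inj₁ _) _ (() , _)

  ⌣U-sym : ∀ u w → u ⌣U w → w ⌣U u
  ⌣U-sym (inj₁ _) (inj₁ _) a⌣b = X.smSym _ _ a⌣b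
  ⌣U-sym (inj₂ _) (inj₂ _) (inj₁ a⌣b) = inj₁ (Y.smSym _ _ a⌣b)
  ⌣U-sym (inj₂ _) (inj₂ _) (inj₂ (att-a , att-b , nested)) = inj₂ (att-b , att-a , nested)
  ⌣U-sym (inj₁ _) (inj₂ _) (sib , att) = att , sib
  ⌣U-sym (inj₂ _) (inj₁ _) (att , sib) = sib , att

  ⌣U-comm : ∀ u w → u ⌣U w ⇔ w ⌣U u
  ⌣U-comm u w = mk⇔ (⌣U-sym u w) (⌣U-sym w u)

  ⌣U-trans : ∀ u v w → u ⌣U v → v ⌣U w → u ⌣U w
  ⌣U-trans (inj₁ a) (inj₁ b) (inj₁ c) a⌣b b⌣c = X.smTrans a b c a⌣b b⌣c
  ⌣U-trans (inj₁ a) (inj₁ b) (inj₂ c) a⌣b ((z , fz⌣b) , att) =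
    (z , X.smTrans _ _ _ fz⌣b (X.smSym _ _ a⌣b)) , att
  ⌣U-trans (inj₁ a) (inj₂ b) (inj₁ c) ((z , fz⌣a) , _) (_ , sib-c) =
    X.smTrans _ _ _ (X.smSym _ _ fz⌣a) (glueSibling-all sib-c z)
  ⌣U-trans (inj₁ a) (inj₂ b) (inj₂ c) (_ , att-b) (inj₁ b⌣c) = contradiction b⌣c (attached-¬⌣ att-b)
  ⌣U-trans (inj₁ a) (inj₂ b) (inj₂ c) (sib , _) (inj₂ (_ , att-c , _)) = sib , att-c
  ⌣U-trans (inj₂ a) (inj₁ b) (inj₁ c) (att , (z , fz⌣b)) b⌣c = att , (z , X.smTrans _ _ _ fz⌣b b⌣c)
  ⌣U-trans (inj₂ a) (inj₁ b) (inj₂ c) (att-a , sib) (_ , att-c) =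
    inj₂ (att-a , att-c , GlueSibling⇒GlueNested sib)
  ⌣U-trans (inj₂ a) (inj₂ b) (inj₁ c) (inj₁ a⌣b) (att-b , _) =
    contradiction (Y.smSym _ _ a⌣b) (attached-¬⌣ att-b)
  ⌣U-trans (inj₂ a) (inj₂ b) (inj₁ c) (inj₂ (att-a , _)) (_ , sib) = att-a , sib
  ⌣U-trans (inj₂ a) (inj₂ b) (inj₂ c) (inj₁ a⌣b) (inj₁ b⌣c) = inj₁ (Y.smTrans a b c a⌣b b⌣c)
  ⌣U-trans (inj₂ a) (inj₂ b) (inj₂ c) (inj₁ a⌣b) (inj₂ (att-b , _)) =
    contradiction (Y.smSym _ _ a⌣b) (attached-¬⌣ att-b)
  ⌣U-trans (inj₂ a) (inj₂ b) (inj₂ c) (inj₂ (_ , att-b , _)) (inj₁ b⌣c) =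
    contradiction b⌣c (attached-¬⌣ att-b)
  ⌣U-trans (inj₂ a) (inj₂ b) (inj₂ c) (inj₂ (att-a , _ , nested)) (inj₂ (_ , att-c , _)) =
    inj₂ (att-a , att-c , nested)

  ⌣U-siblings : ∀ u w → u ⌣U w → ∃ λ c → c <μU u × c <μU w
  ⌣U-siblings (inj₁ a) (inj₁ b) a⌣b with X.smSiblings a b a⌣b
  ... | p , p<μa , p<μb = inj₁ p , from <μU-X p<μa , from <μU-X p<μb
  ⌣U-siblings (inj₂ a) (inj₂ b) (inj₁ a⌣b) with Y.smSiblings a b a⌣b
  ... | p , p<μa , p<μb = inj₂ p , from <μU-Y p<μa , from <μU-Y p<μb
  ⌣U-siblings (inj₂ a) (inj₂ b) (inj₂ (att-a , att-b , z , fz⌣fz)) with X.smSiblings _ _ fz⌣fz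
  ... | p , p<μfz , _ = inj₁ p , from <μU-XY (att-a , z , p<μfz) , from <μU-XY (att-b , z , p<μfz)
  ⌣U-siblings (inj₁ a) (inj₂ b) ((z , fz⌣a) , att) with X.smSiblings _ _ fz⌣a
  ... | p , p<μfz , p<μa = inj₁ p , from <μU-X p<μa , from <μU-XY (att , z , p<μfz)
  ⌣U-siblings (inj₂ a) (inj₁ b) (att , (z , fz⌣b)) with X.smSiblings _ _ fz⌣b
  ... | p , p<μfz , p<μb = inj₁ p , from <μU-XY (att , z , p<μfz) , from <μU-X p<μb

  ⌣U-refl : ∀ c u → c <μU u → u ⌣U u
  ⌣U-refl (inj₁ p) (inj₁ a) m = X.smRefl p a (to <μU-X m)
  ⌣U-refl (inj₂ p) (inj₂ a) m = inj₁ (Y.smRefl p a (to <μU-Y m))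
  ⌣U-refl (inj₁ p) (inj₂ a) m with to <μU-XY m
  ... | att , z , p<μfz = inj₂ (att , att , z , X.smRefl p (fz z) p<μfz)
  ⌣U-refl (inj₂ _) (inj₁ _) (() , _)

  data IncidentU : U → U → Set where
    incidentX : ∀ {v e} → X.Incident v e → IncidentU (inj₁ (inj₁ v)) (inj₁ (inj₂ e))
    incidentY : ∀ {v e} → Y.Incident v e → IncidentU (inj₂ (inj₁ v)) (inj₂ (inj₂ e))

  <μU-incident : ∀ {v e} → IncidentU v e → ∀ c → c <μU e ⇔ c <μU v
  <μU-incident (incidentX i) (inj₁ p) = ⇔.trans <μU-X (⇔.trans (X.<μ-incident i p) (⇔.sym <μU-X))
  <μU-incident (incidentX i) (inj₂ p) = mk⇔ (λ { (() , _) }) (λ { (() , _) })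
  <μU-incident (incidentY i) (inj₂ p) = ⇔.trans <μU-Y (⇔.trans (Y.<μ-incident i p) (⇔.sym <μU-Y))
  <μU-incident (incidentY i) (inj₁ p) =
    ⇔.trans <μU-XY (⇔.trans (⇔.sym (Attached-incident i) ×-⇔ ⇔.refl) (⇔.sym <μU-XY))

  ⌣U-connected : ∀ {v e} c → IncidentU v e → c <μU v → c <μU e → v ⌣U e
  ⌣U-connected (inj₁ p) (incidentX i) p<μv p<μe = X.smConn p _ _ i (to <μU-X p<μv) (to <μU-X p<μe)
  ⌣U-connected (inj₂ _) (incidentX _) (() , _)
  ⌣U-connected (inj₂ p) (incidentY i) p<μv p<μe = inj₁ (Y.smConn p _ _ i (to <μU-Y p<μv) (to <μU-Y p<μe))
  ⌣U-connected (inj₁ p) (incidentY _) p<μv p<μe with to <μU-XY p<μv | to <μU-XY p<μe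
  ... | att-v , z , p<μfz | att-e , _ = inj₂ (att-v , att-e , z , X.smRefl p (fz z) p<μfz)

  eU : Fin X.nE ⊎ Fin Y.nE → U
  eU = Sum.map inj₂ inj₂

  vU : Fin X.nV ⊎ Fin Y.nV → U
  vU = Sum.map inj₁ inj₁

  labE : Fin X.nE ⊎ Fin Y.nE → Maybe (Signature.Gen S)
  labE = [ X.lab , Y.lab ]

  maximal-labE : ∀ s → (∀ u → ¬ eU s <U u) → labE s ≢ nothing
  maximal-labE (inj₁ e) maximal = X.maximalNotHier e (maximal ∘ inj₁)
  maximal-labE (inj₂ e) maximal = Y.maximalNotHier e (maximal ∘ inj₂)

  ⌣U-proper : ∀ s → labE s ≡ nothing → ∃ λ a → ∃ λ b → eU s <μU a × eU s <μU b × ¬ a ⌣U b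
  ⌣U-proper (inj₁ e) hier with X.smProper e hier
  ... | a , b , e<μa , e<μb , a⌣̸b = inj₁ a , inj₁ b , from <μU-X e<μa , from <μU-X e<μb , a⌣̸b
  ⌣U-proper (inj₂ e) hier with Y.smProper e hier
  ... | a , b , e<μa , e<μb , a⌣̸b = inj₂ a , inj₂ b , from <μU-Y e<μa , from <μU-Y e<μb ,
        [ a⌣̸b , (λ (att , _) → attached-TopLevel att (inj₂ e) (proj₁ e<μa)) ]

  data Glued : Fin X.nV ⊎ Fin Y.nV → Fin X.nV ⊎ Fin Y.nV → Set where
    glued : ∀ z → Glued (inj₁ (fV f z)) (inj₂ (fV g z))

  glued? : Decidable Glued
  glued? (inj₁ x) (inj₂ y) = map′ (λ { (z , refl , refl) → glued z }) (λ { (glued z) → z , refl , refl })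
                                  (any? λ z → (fV f z ≟ x) ×-dec (fV g z ≟ y))
  glued? (inj₁ _) (inj₁ _) = no λ ()
  glued? (inj₂ _) _        = no λ ()

  module V = Quotient (quotient⊎ glued?)

  ιV₁ : Fin X.nV → Fin V.size
  ιV₁ = V.quot ∘ inj₁

  ιV₂ : Fin Y.nV → Fin V.size
  ιV₂ = V.quot ∘ inj₂

  ιE₁ : Fin X.nE → Fin (X.nE + Y.nE)
  ιE₁ = join X.nE Y.nE ∘ inj₁

  ιE₂ : Fin Y.nE → Fin (X.nE + Y.nE)
  ιE₂ = join X.nE Y.nE ∘ inj₂

  srcE tgtE : Fin X.nE ⊎ Fin Y.nE → List (Fin V.size)
  srcE = [ map ιV₁ ∘ X.src , map ιV₂ ∘ Y.src ]
  tgtE = [ map ιV₁ ∘ X.tgt , map ιV₂ ∘ Y.tgt ]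

  toU : Fin V.size ⊎ Fin (X.nE + Y.nE) → U
  toU = [ vU ∘ V.rep , eU ∘ splitAt X.nE ]

  fromU : U → Fin V.size ⊎ Fin (X.nE + Y.nE)
  fromU = [ Sum.map ιV₁ ιE₁ , Sum.map ιV₂ ιE₂ ]

  rawPushout : RawEHyp S
  rawPushout = record
    { nV = V.size ; nE = X.nE + Y.nE
    ; src = srcE ∘ splitAt X.nE ; tgt = tgtE ∘ splitAt X.nE ; lab = labE ∘ splitAt X.nE
    ; lt = λ a b → ⌊ toU a <U? toU b ⌋
    ; sm = λ a b → ⌊ toU a ⌣U? toU b ⌋ }

  module P = RawEHyp rawPushout

  P-<⇔ : ∀ a b → a P.< b ⇔ toU a <U toU b
  P-<⇔ _ _ = mk⇔ toWitness fromWitness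

  P-⌣⇔ : ∀ a b → a P.⌣ b ⇔ toU a ⌣U toU b
  P-⌣⇔ _ _ = mk⇔ toWitness fromWitness

  fromU-vU : ∀ s → fromU (vU s) ≡ inj₁ (V.quot s)
  fromU-vU (inj₁ _) = refl
  fromU-vU (inj₂ _) = refl

  fromU-eU : ∀ s → fromU (eU s) ≡ inj₂ (join X.nE Y.nE s)
  fromU-eU (inj₁ _) = refl
  fromU-eU (inj₂ _) = refl

  fromU-toU : ∀ a → fromU (toU a) ≡ a
  fromU-toU (inj₁ w) = trans (fromU-vU (V.rep w)) (cong inj₁ (V.quot-rep w))
  fromU-toU (inj₂ e) = trans (fromU-eU (splitAt X.nE e)) (cong inj₂ (join-splitAt X.nE Y.nE e))

  GlueInvariant : (U → Set) → Set
  GlueInvariant P = ∀ z → P (inj₁ (fz z)) ⇔ P (inj₂ (gz z))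

  toU-fromU : ∀ P → GlueInvariant P → ∀ u → P (toU (fromU u)) ⇔ P u
  toU-fromU P inv (inj₁ (inj₁ x)) = ⇔.sym (V.rep-quot (P ∘ vU) (λ { (glued z) → inv z }) (inj₁ x))
  toU-fromU P inv (inj₂ (inj₁ y)) = ⇔.sym (V.rep-quot (P ∘ vU) (λ { (glued z) → inv z }) (inj₂ y))
  toU-fromU P inv (inj₁ (inj₂ e)) = ≡⇒⇔ (P ∘ eU) (splitAt-join X.nE Y.nE (inj₁ e))
  toU-fromU P inv (inj₂ (inj₂ e)) = ≡⇒⇔ (P ∘ eU) (splitAt-join X.nE Y.nE (inj₂ e))

  <U-glueInvariantˡ : ∀ w → GlueInvariant (_<U w)
  <U-glueInvariantˡ (inj₁ _) z = mk⇔ (λ fz< → contradiction fz< X.vertex-≮) λ ()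
  <U-glueInvariantˡ (inj₂ _) z = mk⇔ (λ ((_ , fz<) , _) → contradiction fz< X.vertex-≮)
                                     (λ gz< → contradiction gz< Y.vertex-≮)

  <U-glueInvariantʳ : ∀ u → GlueInvariant (u <U_)
  <U-glueInvariantʳ (inj₁ a) z = mk⇔ (λ a<fz → (z , a<fz) , inj₁ (attached-gz z))
                                     (λ (enc , _) → encloses-all enc z)
  <U-glueInvariantʳ (inj₂ a) z = mk⇔ (λ ()) (λ a<gz → g-top z a a<gz)

  ⌣U-glueInvariantʳ : ∀ u → GlueInvariant (u ⌣U_)
  ⌣U-glueInvariantʳ (inj₁ a) z = mk⇔ (λ a⌣fz → (z , X.smSym _ _ a⌣fz) , attached-gz z)
                                     (λ (sib , _) → X.smSym _ _ (glueSibling-all sib z))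
  ⌣U-glueInvariantʳ (inj₂ a) z = mk⇔
    (λ (att , sib) → inj₂ (att , attached-gz z , GlueSibling⇒GlueNested sib))
    [ (λ a⌣gz → contradiction (Y.smSym _ _ a⌣gz) (attached-¬⌣ (attached-gz z)))
    , (λ (att , _ , nested) → att , GlueNested⇒GlueSibling z nested) ]

  ⌣U-glueInvariantˡ : ∀ w → GlueInvariant (_⌣U w)
  ⌣U-glueInvariantˡ w z =
    ⇔.trans (⌣U-comm (inj₁ (fz z)) w) (⇔.trans (⌣U-glueInvariantʳ w z) (⌣U-comm w (inj₂ (gz z))))

  fromU-<ˡ : ∀ u c → fromU u P.< c ⇔ u <U toU c
  fromU-<ˡ u c = ⇔.trans (P-<⇔ (fromU u) c) (toU-fromU (_<U toU c) (<U-glueInvariantˡ (toU c)) u)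

  fromU-<ʳ : ∀ c w → c P.< fromU w ⇔ toU c <U w
  fromU-<ʳ c w = ⇔.trans (P-<⇔ c (fromU w)) (toU-fromU (toU c <U_) (<U-glueInvariantʳ (toU c)) w)

  fromU-< : ∀ u w → fromU u P.< fromU w ⇔ u <U w
  fromU-< u w = ⇔.trans (fromU-<ˡ u (fromU w)) (toU-fromU (u <U_) (<U-glueInvariantʳ u) w)

  fromU-⌣ˡ : ∀ u c → fromU u P.⌣ c ⇔ u ⌣U toU c
  fromU-⌣ˡ u c = ⇔.trans (P-⌣⇔ (fromU u) c) (toU-fromU (_⌣U toU c) (⌣U-glueInvariantˡ (toU c)) u)

  fromU-⌣ : ∀ u w → fromU u P.⌣ fromU w ⇔ u ⌣U w
  fromU-⌣ u w = ⇔.trans (fromU-⌣ˡ u (fromU w)) (toU-fromU (u ⌣U_) (⌣U-glueInvariantʳ u) w)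

  fromU-<μ : ∀ u w → fromU u P.<μ fromU w ⇔ u <μU w
  fromU-<μ u w = mk⇔
    (λ (u<w , imm) → to (fromU-< u w) u<w ,
       λ c u<c c<w → imm (fromU c) (from (fromU-< u c) u<c) (from (fromU-< c w) c<w))
    (λ (u<w , imm) → from (fromU-< u w) u<w ,
       λ c u<c c<w → imm (toU c) (to (fromU-<ˡ u c) u<c) (to (fromU-<ʳ c w) c<w))

  fromU-<μˡ : ∀ u c → fromU u P.<μ c ⇔ u <μU toU c
  fromU-<μˡ u c = subst (λ b → fromU u P.<μ b ⇔ u <μU toU c) (fromU-toU c) (fromU-<μ u (toU c))

  fromU-<μʳ : ∀ c w → c P.<μ fromU w ⇔ toU c <μU w
  fromU-<μʳ c w = subst (λ a → a P.<μ fromU w ⇔ toU c <μU w) (fromU-toU c) (fromU-<μ (toU c) w)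

  toU-<μ : ∀ a b → a P.<μ b ⇔ toU a <μU toU b
  toU-<μ a b = subst (λ b' → a P.<μ b' ⇔ toU a <μU toU b) (fromU-toU b) (fromU-<μʳ a (toU b))

  toU-injective : ∀ {a b} → toU a ≡ toU b → a ≡ b
  toU-injective {a} {b} eq = trans (sym (fromU-toU a)) (trans (cong fromU eq) (fromU-toU b))

  P-incident : ∀ {v e} → P.Incident v e → ∃ λ u → fromU u ≡ inj₁ v × IncidentU u (toU (inj₂ e))
  P-incident {v} {e} = incident (splitAt X.nE e)
    where
      incident : ∀ s → v ∈ srcE s ⊎ v ∈ tgtE s → ∃ λ u → fromU u ≡ inj₁ v × IncidentU u (eU s)
      incident (inj₁ e) i with ∈-map⁻-⊎ ιV₁ i
      ... | x , inc , refl = inj₁ (inj₁ x) , refl , incidentX inc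
      incident (inj₂ e) i with ∈-map⁻-⊎ ιV₂ i
      ... | y , inc , refl = inj₂ (inj₁ y) , refl , incidentY inc

  arities-E : ∀ s σ → labE s ≡ just σ →
              (length (srcE s) ≡ Signature.arity S σ) × (length (tgtE s) ≡ Signature.coarity S σ)
  arities-E (inj₁ e) σ eq = let (a , c) = X.arities e σ eq in
    trans (length-map ιV₁ (X.src e)) a , trans (length-map ιV₁ (X.tgt e)) c
  arities-E (inj₂ e) σ eq = let (a , c) = Y.arities e σ eq in
    trans (length-map ιV₂ (Y.src e)) a , trans (length-map ιV₂ (Y.tgt e)) c

  vU-¬Hierarchical : ∀ s → ¬ HierarchicalU (vU s)
  vU-¬Hierarchical (inj₁ _) ()
  vU-¬Hierarchical (inj₂ _) ()

  eU-Hierarchical : ∀ s → HierarchicalU (eU s) → labE s ≡ nothing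
  eU-Hierarchical (inj₁ _) (X.hierarchical h) = h
  eU-Hierarchical (inj₂ _) (Y.hierarchical h) = h

  predHier-P : ∀ x y → x P.< y → ∃ λ e → (x ≡ inj₂ e) × P.Hierarchical e
  predHier-P x y x<y = hierarchical-rep x (<U⇒Hierarchical (toU x) (toU y) (to (P-<⇔ x y) x<y))
    where
      hierarchical-rep : ∀ x → HierarchicalU (toU x) → ∃ λ e → (x ≡ inj₂ e) × P.Hierarchical e
      hierarchical-rep (inj₁ w) hier = contradiction hier (vU-¬Hierarchical (V.rep w))
      hierarchical-rep (inj₂ e) hier = e , refl , eU-Hierarchical (splitAt X.nE e) hier

  <μ-incident-P : ∀ {v e} → P.Incident v e → ∀ p → p P.<μ inj₂ e ⇔ p P.<μ inj₁ v
  <μ-incident-P {v} {e} i p = let (u , u≡v , incU) = P-incident i in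
    ⇔.trans (toU-<μ p (inj₂ e))
            (⇔.trans (<μU-incident incU (toU p)) (⇔.trans (⇔.sym (fromU-<μʳ p u)) (≡⇒⇔ (p P.<μ_) u≡v)))

  isEHypPushout : IsEHyp rawPushout
  isEHypPushout = record
    { arities = λ e → arities-E (splitAt X.nE e)
    ; irrefl = λ x x<x → <U-irrefl (toU x) (to (P-<⇔ x x) x<x)
    ; trans = λ x y z x<y y<z →
        from (P-<⇔ x z) (<U-trans (toU x) (toU y) (toU z) (to (P-<⇔ x y) x<y) (to (P-<⇔ y z) y<z))
    ; predHier = predHier-P
    ; uniqueImm = λ p q x p<μx q<μx →
        toU-injective (<μU-unique (toU p) (toU q) (toU x) (to (toU-<μ p x) p<μx) (to (toU-<μ q x) q<μx))
    ; maximalNotHier = λ e maximal →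
        maximal-labE (splitAt X.nE e) (λ u e<u → maximal (fromU u) (from (fromU-<ʳ (inj₂ e) u) e<u))
    ; incidentImm = λ v e i p → to (<μ-incident-P i p) , from (<μ-incident-P i p)
    ; smSiblings = λ x y x⌣y → let (c , c<μx , c<μy) = ⌣U-siblings (toU x) (toU y) (to (P-⌣⇔ x y) x⌣y) in
        fromU c , from (fromU-<μˡ c x) c<μx , from (fromU-<μˡ c y) c<μy
    ; smRefl = λ p x p<μx → from (P-⌣⇔ x x) (⌣U-refl (toU p) (toU x) (to (toU-<μ p x) p<μx))
    ; smSym = λ x y x⌣y → from (P-⌣⇔ y x) (⌣U-sym (toU x) (toU y) (to (P-⌣⇔ x y) x⌣y))
    ; smTrans = λ x y z x⌣y y⌣z →
        from (P-⌣⇔ x z) (⌣U-trans (toU x) (toU y) (toU z) (to (P-⌣⇔ x y) x⌣y) (to (P-⌣⇔ y z) y⌣z))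
    ; smConn = λ p v e i p<μv p<μe → let (u , u≡v , incU) = P-incident i in
        subst (P._⌣ inj₂ e) u≡v (from (fromU-⌣ˡ u (inj₂ e))
          (⌣U-connected (toU p) incU (to (fromU-<μʳ p u) (subst (p P.<μ_) (sym u≡v) p<μv))
                                     (to (toU-<μ p (inj₂ e)) p<μe)))
    ; smProper = λ e hier → let (a , b , e<μa , e<μb , a⌣̸b) = ⌣U-proper (splitAt X.nE e) hier in
        fromU a , fromU b , from (fromU-<μʳ (inj₂ e) a) e<μa , from (fromU-<μʳ (inj₂ e) b) e<μb ,
        a⌣̸b ∘ to (fromU-⌣ a b)
    }

  Pushout : EHyp S
  Pushout = record { raw = rawPushout ; wf = isEHypPushout }

  ι₁ : Hom X Pushout
  ι₁ = record
    { fV = ιV₁ ; fE = ιE₁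
    ; presSrc = λ e → cong srcE (splitAt-join X.nE Y.nE (inj₁ e))
    ; presTgt = λ e → cong tgtE (splitAt-join X.nE Y.nE (inj₁ e))
    ; presLab = λ e → cong labE (splitAt-join X.nE Y.nE (inj₁ e))
    ; presImm = λ p x p<μx → from (fromU-<μ (inj₁ p) (inj₁ x)) (from <μU-X p<μx)
    ; presSm = λ x y x⌣y → from (fromU-⌣ (inj₁ x) (inj₁ y)) x⌣y }

  ι₂ : Hom Y Pushout
  ι₂ = record
    { fV = ιV₂ ; fE = ιE₂
    ; presSrc = λ e → cong srcE (splitAt-join X.nE Y.nE (inj₂ e))
    ; presTgt = λ e → cong tgtE (splitAt-join X.nE Y.nE (inj₂ e))
    ; presLab = λ e → cong labE (splitAt-join X.nE Y.nE (inj₂ e))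
    ; presImm = λ p x p<μx → from (fromU-<μ (inj₂ p) (inj₂ x)) (from <μU-Y p<μx)
    ; presSm = λ x y x⌣y → from (fromU-⌣ (inj₂ x) (inj₂ y)) (inj₁ x⌣y) }

  module Universal (Q : EHyp S) (i : Hom X Q) (j : Hom Y Q) (comm : CompEq i f j g) where
    module Q = EHypProperties Q

    hV : Fin X.nV ⊎ Fin Y.nV → Fin Q.nV
    hV = [ fV i , fV j ]

    hE : Fin X.nE ⊎ Fin Y.nE → Fin Q.nE
    hE = [ fE i , fE j ]

    hU : U → Q.El
    hU = [ fEl i , fEl j ]

    i-fz : ∀ z → fEl i (fz z) ≡ fEl j (gz z)
    i-fz z = cong inj₁ (proj₁ comm z)

    hV-rep-quot : ∀ s → hV (V.rep (V.quot s)) ≡ hV s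
    hV-rep-quot s =
      to (V.rep-quot (λ t → hV t ≡ hV s) (λ { (glued z) → ≡⇒⇔ (_≡ hV s) (proj₁ comm z) }) s) refl

    map-hV : ∀ {A : Set} (k : A → Fin X.nV ⊎ Fin Y.nV) xs →
             map (hV ∘ k) xs ≡ map (hV ∘ V.rep) (map (V.quot ∘ k) xs)
    map-hV k xs = trans (map-cong (λ x → sym (hV-rep-quot (k x))) xs) (map-∘ xs)

    parent-attached : ∀ {p z b} → p X.<μ fz z → Attached b → fEl i p Q.<μ fEl j b
    parent-attached {p} {b = b} p<μfz = attached-induction (λ y → fEl i p Q.<μ fEl j y)
      (λ { (link {v} {e} inc _) → ⇔.sym (Q.<μ-incident (presIncident j {v} {e} inc) (fEl i p)) })
      (λ z' → subst (fEl i p Q.<μ_) (i-fz z') (presImm i p (fz z') (<μ-fz z' p<μfz))) b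

    sibling-attached : ∀ {z b} → fz z X.⌣ fz z → Attached b → fEl i (fz z) Q.⌣ fEl j b
    sibling-attached {z} {b} fz⌣fz att with X.smSiblings _ _ fz⌣fz
    ... | p , p<μfz , _ = attached-induction Sib step base b att (parent-attached p<μfz att)
      where
        Sib : Y.El → Set
        Sib y = fEl i p Q.<μ fEl j y → fEl i (fz z) Q.⌣ fEl j y
        step : Invariant Link Sib
        step (link {v} {e} inc _) = mk⇔
          (λ sib-v p<μe → let p<μv = to (Q.<μ-incident inc′ _) p<μe in
             Q.smTrans _ _ _ (sib-v p<μv) (Q.smConn _ _ _ inc′ p<μv p<μe))
          (λ sib-e p<μv → let p<μe = from (Q.<μ-incident inc′ _) p<μv in
             Q.smTrans _ _ _ (sib-e p<μe) (Q.smSym _ _ (Q.smConn _ _ _ inc′ p<μv p<μe)))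
          where inc′ = presIncident j {v} {e} inc
        base : ∀ z' → Sib (gz z')
        base z' _ = subst (fEl i (fz z) Q.⌣_) (i-fz z')
                      (presSm i _ _ (X.smSym _ _ (proj₁ (f-smSet z z') fz⌣fz)))

    glueSibling-attached : ∀ {a b} → GlueSibling a → Attached b → fEl i a Q.⌣ fEl j b
    glueSibling-attached (z , fz⌣a) att =
      Q.smTrans _ _ _ (Q.smSym _ _ (presSm i _ _ fz⌣a))
                      (sibling-attached (X.smTrans _ _ _ fz⌣a (X.smSym _ _ fz⌣a)) att)

    hU-<μ : ∀ u w → u <μU w → hU u Q.<μ hU w
    hU-<μ (inj₁ a) (inj₁ b) m = presImm i a b (to <μU-X m)
    hU-<μ (inj₂ a) (inj₂ b) m = presImm j a b (to <μU-Y m)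
    hU-<μ (inj₁ a) (inj₂ b) m = let (att , z , a<μfz) = to <μU-XY m in parent-attached a<μfz att
    hU-<μ (inj₂ _) (inj₁ _) (() , _)

    hU-⌣ : ∀ u w → u ⌣U w → hU u Q.⌣ hU w
    hU-⌣ (inj₁ a) (inj₁ b) a⌣b = presSm i a b a⌣b
    hU-⌣ (inj₂ a) (inj₂ b) (inj₁ a⌣b) = presSm j a b a⌣b
    hU-⌣ (inj₂ a) (inj₂ b) (inj₂ (att-a , att-b , _ , fz⌣fz)) =
      Q.smTrans _ _ _ (Q.smSym _ _ (sibling-attached fz⌣fz att-a)) (sibling-attached fz⌣fz att-b)
    hU-⌣ (inj₁ a) (inj₂ b) (sib , att) = glueSibling-attached sib att
    hU-⌣ (inj₂ a) (inj₁ b) (att , sib) = Q.smSym _ _ (glueSibling-attached sib att)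

    hU-toU : ∀ a → Sum.map (hV ∘ V.rep) (hE ∘ splitAt X.nE) a ≡ hU (toU a)
    hU-toU (inj₁ w) with V.rep w
    ... | inj₁ _ = refl
    ... | inj₂ _ = refl
    hU-toU (inj₂ e) with splitAt X.nE e
    ... | inj₁ _ = refl
    ... | inj₂ _ = refl

    src-h : ∀ s → Q.src (hE s) ≡ map (hV ∘ V.rep) (srcE s)
    src-h (inj₁ e) = trans (presSrc i e) (map-hV inj₁ (X.src e))
    src-h (inj₂ e) = trans (presSrc j e) (map-hV inj₂ (Y.src e))

    tgt-h : ∀ s → Q.tgt (hE s) ≡ map (hV ∘ V.rep) (tgtE s)
    tgt-h (inj₁ e) = trans (presTgt i e) (map-hV inj₁ (X.tgt e))
    tgt-h (inj₂ e) = trans (presTgt j e) (map-hV inj₂ (Y.tgt e))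

    lab-h : ∀ s → Q.lab (hE s) ≡ labE s
    lab-h (inj₁ e) = presLab i e
    lab-h (inj₂ e) = presLab j e

    mediator : Hom Pushout Q
    mediator = record
      { fV = hV ∘ V.rep ; fE = hE ∘ splitAt X.nE
      ; presSrc = src-h ∘ splitAt X.nE
      ; presTgt = tgt-h ∘ splitAt X.nE
      ; presLab = lab-h ∘ splitAt X.nE
      ; presImm = λ p x p<μx → subst₂ Q._<μ_ (sym (hU-toU p)) (sym (hU-toU x))
                                 (hU-<μ (toU p) (toU x) (to (toU-<μ p x) p<μx))
      ; presSm = λ x y x⌣y → subst₂ Q._⌣_ (sym (hU-toU x)) (sym (hU-toU y))
                               (hU-⌣ (toU x) (toU y) (to (P-⌣⇔ x y) x⌣y)) }

    mediator-ι₁ : Factors mediator ι₁ i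
    mediator-ι₁ = hV-rep-quot ∘ inj₁ , λ e → cong hE (splitAt-join X.nE Y.nE (inj₁ e))

    mediator-ι₂ : Factors mediator ι₂ j
    mediator-ι₂ = hV-rep-quot ∘ inj₂ , λ e → cong hE (splitAt-join X.nE Y.nE (inj₂ e))

    mediator-unique : ∀ h → Factors h ι₁ i → Factors h ι₂ j → HomEq h mediator
    mediator-unique h (h-ιV₁ , h-ιE₁) (h-ιV₂ , h-ιE₂) =
      (λ w → trans (cong (fV h) (sym (V.quot-rep w))) (h-quot (V.rep w))) ,
      (λ e → trans (cong (fE h) (sym (join-splitAt X.nE Y.nE e))) (h-join (splitAt X.nE e)))
      where
        h-quot : ∀ s → fV h (V.quot s) ≡ hV s
        h-quot = [ h-ιV₁ , h-ιV₂ ]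
        h-join : ∀ s → fE h (join X.nE Y.nE s) ≡ hE s
        h-join = [ h-ιE₁ , h-ιE₂ ]

  isPushout : Discrete Z → IsPushout f g ι₁ ι₂
  isPushout discrete = record
    { commutes = (λ z → V.glue (glued z)) , (λ e → contradiction (subst Fin discrete e) ¬Fin0)
    ; universal = λ Q i j comm → let open Universal Q i j comm in
        mediator , mediator-ι₁ , mediator-ι₂ , mediator-unique }

IsPushout-swap : ∀ {S} {Z X Y P : EHyp S} {f : Hom Z X} {g : Hom Z Y} {i : Hom X P} {j : Hom Y P} →
                 IsPushout f g i j → IsPushout g f j i
IsPushout-swap po = record
  { commutes = (λ v → sym (proj₁ commutes v)) , (λ e → sym (proj₂ commutes e))
  ; universal = λ Q j′ i′ comm →
      let comm′ = (λ v → sym (proj₁ comm v)) , (λ e → sym (proj₂ comm e))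
          (u , u-i , u-j , unique) = universal Q i′ j′ comm′
      in u , u-j , u-i , λ u′ u′-j u′-i → unique u′ u′-i u′-j }
  where open IsPushout po

glueTopLevelOnOneSide : ∀ {S} {Z X Y : EHyp S} (f : Hom Z X) (g : Hom Z Y) →
  (∀ zi zj → EHyp.preds X (inj₁ (fV f zi)) ≐ EHyp.preds X (inj₁ (fV f zj))) →
  (∀ z → ¬ Empty (EHyp.preds Y (inj₁ (fV g z))) → Empty (EHyp.preds X (inj₁ (fV f z)))) →
  (∀ z → Empty (EHyp.preds Y (inj₁ (fV g z)))) ⊎ (∀ z → Empty (EHyp.preds X (inj₁ (fV f z))))
glueTopLevelOnOneSide {Y = Y} f g f-preds g-nested⇒f-top
  with all? (EHypProperties.TopLevel? Y ∘ inj₁ ∘ fV g)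
... | yes g-top = inj₁ g-top
... | no ¬g-top = let (z₀ , g₀-nested) = ¬∀⟶∃¬ _ _ (EHypProperties.TopLevel? Y ∘ inj₁ ∘ fV g) ¬g-top in
  inj₂ λ z y y<fz → g-nested⇒f-top z₀ g₀-nested y (proj₁ (f-preds z z₀) y<fz)

mainTheorem7 : (S : Signature) (Z X Y : EHyp S) (f : Hom Z X) (g : Hom Z Y) →
    Discrete Z →
    (∀ (vi vj : Fin (EHyp.nV Z)) →
      (EHyp.preds X (inj₁ (fV f vi)) ≐ EHyp.preds X (inj₁ (fV f vj))) ×
      (EHyp.preds Y (inj₁ (fV g vi)) ≐ EHyp.preds Y (inj₁ (fV g vj)))) →
    (∀ (v : Fin (EHyp.nV Z)) →
      (¬ Empty (EHyp.preds X (inj₁ (fV f v))) → Empty (EHyp.preds Y (inj₁ (fV g v)))) ×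
      (¬ Empty (EHyp.preds Y (inj₁ (fV g v))) → Empty (EHyp.preds X (inj₁ (fV f v))))) →
    (∀ (vi vj : Fin (EHyp.nV Z)) →
      (EHyp.smSet X (inj₁ (fV f vi)) ≐ EHyp.smSet X (inj₁ (fV f vj))) ×
      (EHyp.smSet Y (inj₁ (fV g vi)) ≐ EHyp.smSet Y (inj₁ (fV g vj)))) →
    PushoutExists f g
mainTheorem7 S Z X Y f g discrete preds-eq nested-excl smSet-eq
  with glueTopLevelOnOneSide f g (λ zi zj → proj₁ (preds-eq zi zj)) (λ z → proj₂ (nested-excl z))
... | inj₁ g-top = _ , _ , _ ,
  Gluing.isPushout f g (λ zi zj → proj₁ (preds-eq zi zj)) (λ zi zj → proj₁ (smSet-eq zi zj)) g-top discrete
... | inj₂ f-top = _ , _ , _ , IsPushout-swap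
  (Gluing.isPushout g f (λ zi zj → proj₂ (preds-eq zi zj)) (λ zi zj → proj₂ (smSet-eq zi zj)) f-top discrete)
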